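{- For every $n\ge1$, the map $\phi\colon\mathrm{zRTT}_0(n)\to\mathrm{zLD}^2(n)$ is injective.
   Context: A tiered rooted tree on $n+1$ vertices is a tree $T$ with vertex set $V$, $|V|=n+1$, a root $r\in V$, and functions $w$ (label) and $\mathrm{lv}$ (level) on $V$ with $w(r)=\mathrm{lv}(r)=0$ and $w(v),\mathrm{lv}(v)\in\mathbb{Z}_{\ge1}$ for $v\ne r$, such that: for every edge $\{u,v\}$ with $u,v\ne r$, $w(u)\neq w(v)$, $\mathrm{lv}(u)\ne\mathrm{lv}(v)$ and $w(u)<w(v)\iff\mathrm{lv}(u)<\mathrm{lv}(v)$; and distinct vertices with the same parent have different pairs $(w,\mathrm{lv})$. Trees are considered up to isomorphism preserving root, labels and levels. The parent $p(v)$ of $v\ne r$ is its neighbour closer to $r$; $u$ is a descendant of $v$ if $v=p^k(u)$ for some $k>0$. Vertices $u,v$ are compatible, $u\bowtie v$, if ($\mathrm{lv}(u)<\mathrm{lv}(v)$ and $w(u)<w(v)$) or ($\mathrm{lv}(u)>\mathrm{lv}(v)$ and $w(u)>w(v)$). A pair $(u,v)$ of non-root vertices is an inversion if $v$ is a descendant of $u$, $v\bowtie p(u)$, and either $w(v)<w(u)$ or ($w(v)=w(u)$ and $\mathrm{lv}(v)>\mathrm{lv}(u)$). $\mathrm{zRTT}_0(n)$ is the set of tiered rooted trees on $n+1$ vertices with no inversions. With $L,l$ the max and min level over non-root vertices, $\mathrm{lv}'(v)=L+l-\mathrm{lv}(v)$. The map $\phi$: explore $T$ depth-first (preorder) from the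 root, children of a vertex being visited in decreasing order of label, and among equal labels in increasing order of level. Let $v_0=r,v_1,\dots,v_n$ be the visiting order and $\phi(T)=(a,b)$ with $a_i=w(v_{n+1-i})$, $b_i=\mathrm{lv}'(v_{n+1-i})$, $i\in[n]$. $\mathrm{zLD}^2(n)$ is the set of pairs of sequences $(a,b)$ of positive integers of length $n$ with $a_i<a_{i+1}$ or $b_i<b_{i+1}$ for each $1\le i\le n-1$; $\phi$ takes values in this set. -}

module Defs where

open import Data.Nat using (ℕ; zero; suc; _+_; _∸_; _≤_; _<_; _⊔_; _⊓_; _≡ᵇ_; _<ᵇ_)
open import Data.Bool using (Bool; true; false; _∨_; _∧_; if_then_else_)
open import Data.Product using (_×_; _,_; proj₁; proj₂)
open import Data.Sum using (_⊎_)
open import Data.List using (List; []; _∷_; _++_; map; foldr; reverse)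
open import Data.List.Relation.Unary.All using (All)
open import Data.List.Relation.Unary.Unique.Propositional using (Unique)
open import Data.List.Relation.Binary.Permutation.Homogeneous using (Permutation)
open import Relation.Binary.PropositionalEquality using (_≡_; _≢_)
open import Relation.Nullary using (¬_)
open import Function using (_⇔_)

-- Rooted trees whose vertices carry a pair (label w, level lv).
-- A vertex is `node w lv children`; the list order of children is
-- irrelevant (trees are compared up to isomorphism, see _≅_ below).

data Tree : Set where
  node : ℕ → ℕ → List Tree → Tree

Key : Set
Key = ℕ × ℕ

key : Tree → Key
key (node w l _) = w , l

wt : Key → ℕ
wt = proj₁

lvl : Key → ℕ
lvl = proj₂

mutual
  size : Tree → ℕ
  size (node _ _ cs) = suc (sizeF cs)

  sizeF : List Tree → ℕ
  sizeF []       = 0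
  sizeF (c ∷ cs) = size c + sizeF cs

mutual
  verts : Tree → List Key
  verts (node w l cs) = (w , l) ∷ vertsF cs

  vertsF : List Tree → List Key
  vertsF []       = []
  vertsF (c ∷ cs) = verts c ++ vertsF cs

descendants : Tree → List Key
descendants (node _ _ cs) = vertsF cs

data _≅_ : Tree → Tree → Set where
  node : ∀ {w w′ l l′ cs cs′} → w ≡ w′ → l ≡ l′ →
         Permutation _≅_ cs cs′ → node w l cs ≅ node w′ l′ cs′

EdgeOK : Key → Key → Set
EdgeOK u v = (wt u ≢ wt v) × (lvl u ≢ lvl v) × ((wt u < wt v) ⇔ (lvl u < lvl v))

SiblingsDistinct : List Tree → Set
SiblingsDistinct cs = Unique (map key cs)

data TieredBelow (p : Key) : Tree → Set where
  mk : ∀ {w l cs} → 1 ≤ w → 1 ≤ l → EdgeOK p (w , l) →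
       SiblingsDistinct cs → All (TieredBelow (w , l)) cs →
       TieredBelow p (node w l cs)

data TieredBelowRoot : Tree → Set where
  mk : ∀ {w l cs} → 1 ≤ w → 1 ≤ l →
       SiblingsDistinct cs → All (TieredBelow (w , l)) cs →
       TieredBelowRoot (node w l cs)

data Tiered : Tree → Set where
  mk : ∀ {cs} → SiblingsDistinct cs → All TieredBelowRoot cs →
       Tiered (node 0 0 cs)

Compatible : Key → Key → Set
Compatible u v = ((lvl u < lvl v) × (wt u < wt v)) ⊎ ((lvl v < lvl u) × (wt v < wt u))

-- (u , v) with parent p(u) = p is an inversion (v a descendant of u)
InversionCond : (p u v : Key) → Set
InversionCond p u v =
  Compatible v p × ((wt v < wt u) ⊎ ((wt v ≡ wt u) × (lvl u < lvl v)))

data NoInvBelow (p : Key) : Tree → Set where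
  mk : ∀ {w l cs} →
       All (λ v → ¬ InversionCond p (w , l) v) (vertsF cs) →
       All (NoInvBelow (w , l)) cs →
       NoInvBelow p (node w l cs)

NoInversion : Tree → Set
NoInversion (node w l cs) = All (NoInvBelow (w , l)) cs

InZRTT₀ : ℕ → Tree → Set
InZRTT₀ n t = Tiered t × NoInversion t × size t ≡ suc n

visitsBefore : Key → Key → Bool
visitsBefore x y = (wt y <ᵇ wt x) ∨ ((wt x ≡ᵇ wt y) ∧ (lvl x <ᵇ lvl y))

insertT : Tree → List Tree → List Tree
insertT x []       = x ∷ []
insertT x (y ∷ ys) = if visitsBefore (key x) (key y) then x ∷ y ∷ ys else y ∷ insertT x ys

sortT : List Tree → List Tree
sortT = foldr insertT []

mutual
  canon : Tree → Tree
  canon (node w l cs) = node w l (sortT (canonF cs))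

  canonF : List Tree → List Tree
  canonF []       = []
  canonF (c ∷ cs) = canon c ∷ canonF cs

visitOrder : Tree → List Key
visitOrder t = descendants (canon t)

maxLevel : List Key → ℕ
maxLevel ks = foldr _⊔_ 0 (map lvl ks)

-- minimum of the levels (for a non-empty list; all levels are ≤ maxLevel)
minLevel : List Key → ℕ
minLevel ks = foldr _⊓_ (maxLevel ks) (map lvl ks)

φ : Tree → List ℕ × List ℕ
φ t = map wt rev , map (λ k → (L + m) ∸ lvl k) rev
  where
    vs  = visitOrder t
    rev = reverse vs
    L   = maxLevel vs
    m   = minLevel vs

-- The level reflection lv ↦ L + l − lv preserves the extreme levels L and l, so
-- it is an involution, and φ(T) determines the preorder sequence of (label, level)
-- pairs. Once children are listed in visiting order, an inversion-free tree is
-- recovered from that sequence: the vertex following the subtree of u is the next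
-- sibling v of u, which is compatible with p(u) and visited after u; were v instead
-- a descendant of u, (u, v) would be an inversion.
module Submission where

open import Defs
open import Data.Bool using (T; true; false)
open import Data.Bool.Properties using (T-∨; T-∧)
open import Data.Empty using (⊥; ⊥-elim)
open import Data.List using (List; []; _∷_; _++_; map; foldr; reverse)
import Data.List as List
open import Data.List.Properties
  using (∷-injective; map-∘; map-id-local; reverse-map; reverse-injective; foldr-preservesᵇ)
open import Data.List.Membership.Propositional using (_∈_)
open import Data.List.Membership.Propositional.Properties using (∈-map⁺; ∈-++⁺ʳ; foldr-selective)
open import Data.List.Relation.Unary.All as All using (All; []; _∷_)
import Data.List.Relation.Unary.All.Properties as All
open import Data.List.Relation.Unary.Any using (here; there)
open import Data.List.Relation.Unary.AllPairs using ([]; _∷_)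
open import Data.List.Relation.Unary.Linked as Linked using (Linked; []; [-]; _∷_; _∷′_)
open import Data.List.Relation.Unary.Unique.Propositional using (Unique)
open import Data.List.Relation.Binary.Pointwise using (Pointwise; []; _∷_)
open import Data.List.Relation.Binary.Permutation.Homogeneous as Homogeneous
  using (Permutation; refl; trans)
open import Data.List.Relation.Binary.Permutation.Propositional
  using (_↭_; prep; swap; ↭-sym; ↭⇒↭ₛ)
  renaming (refl to ↭-refl; trans to ↭-trans)
open import Data.List.Relation.Binary.Permutation.Propositional.Properties
  using (All-resp-↭; ++⁺; ++⁺ˡ; shifts)
open import Data.Maybe using (just)
open import Data.Maybe.Relation.Binary.Connected using (Connected; just)
open import Data.Nat using (ℕ; _+_; _∸_; _≤_; _<_; _⊔_; _⊓_; z≤n)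
open import Data.Nat.Properties
  using ( ≤-trans; ≤-antisym; <-cmp; <⇒≯; m≤m+n; m+n∸m≡n; m+n∸n≡m; m∸[m∸n]≡n; ∸-monoʳ-≤
        ; m≤m⊔n; m≤n⊔m; ⊔-identityʳ; ⊔-sel; ⊔-lub; m⊓n≤m; m⊓n≤n; ⊓-sel; ⊓-glb
        ; <ᵇ⇒<; <⇒<ᵇ; ≡ᵇ⇒≡; ≡⇒≡ᵇ )
open import Data.Product using (_×_; _,_; proj₁; proj₂; ∃₂)
open import Data.Sum using (_⊎_; inj₁; inj₂)
open import Data.Unit using (tt)
open import Function using (_on_; Equivalence)
open import Relation.Binary.Definitions using (tri<; tri≈; tri>)
open import Relation.Binary.PropositionalEquality
  using (_≡_; _≢_; refl; sym; cong; cong₂; subst; subst₂; module ≡-Reasoning)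
open import Relation.Nullary using (¬_)

open Equivalence using (to; from)

maximum : List ℕ → ℕ
maximum = foldr _⊔_ 0

minimum : List ℕ → ℕ
minimum xs = foldr _⊓_ (maximum xs) xs

mirror : List ℕ → List ℕ
mirror xs = map (maximum xs + minimum xs ∸_) xs

MinMax : ℕ → ℕ → List ℕ → Set
MinMax m M xs = m ∈ xs × M ∈ xs × All (λ y → m ≤ y × y ≤ M) xs

xs≤maximum : ∀ xs → All (_≤ maximum xs) xs
xs≤maximum []       = []
xs≤maximum (x ∷ xs) =
  m≤m⊔n x _ ∷ All.map (λ y≤ → ≤-trans y≤ (m≤n⊔m x _)) (xs≤maximum xs)

maximum-∈ : ∀ x xs → maximum (x ∷ xs) ∈ x ∷ xs
maximum-∈ x []       = here (⊔-identityʳ x)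
maximum-∈ x (y ∷ ys) with ⊔-sel x (maximum (y ∷ ys))
... | inj₁ eq = here eq
... | inj₂ eq = there (subst (_∈ y ∷ ys) (sym eq) (maximum-∈ y ys))

foldr-⊓≤xs : ∀ e xs → All (foldr _⊓_ e xs ≤_) xs
foldr-⊓≤xs e []       = []
foldr-⊓≤xs e (x ∷ xs) =
  m⊓n≤m x _ ∷ All.map (≤-trans (m⊓n≤n x _)) (foldr-⊓≤xs e xs)

minimum-∈ : ∀ x xs → minimum (x ∷ xs) ∈ x ∷ xs
minimum-∈ x xs with foldr-selective ⊓-sel (maximum (x ∷ xs)) (x ∷ xs)
... | inj₁ eq = subst (_∈ x ∷ xs) (sym eq) (maximum-∈ x xs)
... | inj₂ m∈ = m∈

minMax : ∀ x xs → MinMax (minimum (x ∷ xs)) (maximum (x ∷ xs)) (x ∷ xs)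
minMax x xs =
  minimum-∈ x xs , maximum-∈ x xs ,
  All.zip (foldr-⊓≤xs _ (x ∷ xs) , xs≤maximum (x ∷ xs))

minMax-unique : ∀ {m M xs} → MinMax m M xs → minimum xs ≡ m × maximum xs ≡ M
minMax-unique {xs = xs} (m∈ , M∈ , bounded) =
  ≤-antisym (All.lookup (foldr-⊓≤xs _ xs) m∈)
            (foldr-preservesᵇ ⊓-glb (All.lookup (xs≤maximum xs) m∈) (All.map proj₁ bounded)) ,
  ≤-antisym (foldr-preservesᵇ ⊔-lub z≤n (All.map proj₂ bounded))
            (All.lookup (xs≤maximum xs) M∈)

minMax-∸ : ∀ c {m M xs} → MinMax m M xs → MinMax (c ∸ M) (c ∸ m) (map (c ∸_) xs)
minMax-∸ c (m∈ , M∈ , bounded) =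
  ∈-map⁺ (c ∸_) M∈ , ∈-map⁺ (c ∸_) m∈ ,
  All.map⁺ (All.map (λ (m≤y , y≤M) → ∸-monoʳ-≤ c y≤M , ∸-monoʳ-≤ c m≤y) bounded)

mirror-involutive : ∀ xs → mirror (mirror xs) ≡ xs
mirror-involutive []           = refl
mirror-involutive xs@(x ∷ xs′) = begin
  map (c′ ∸_) (map (c ∸_) xs) ≡⟨ cong (λ d → map (d ∸_) (map (c ∸_) xs)) c′≡c ⟩
  map (c ∸_) (map (c ∸_) xs)  ≡⟨ map-∘ xs ⟨
  map (λ y → c ∸ (c ∸ y)) xs  ≡⟨ map-id-local c∸[c∸y]≡y ⟩
  xs                          ∎
  where
  open ≡-Reasoning
  M m c c′ : ℕ
  M  = maximum xs
  m  = minimum xs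
  c  = M + m
  c′ = maximum (mirror xs) + minimum (mirror xs)

  c∸[c∸y]≡y : All (λ y → c ∸ (c ∸ y) ≡ y) xs
  c∸[c∸y]≡y = All.map (λ (_ , y≤M) → m∸[m∸n]≡n (≤-trans y≤M (m≤m+n M m)))
                      (proj₂ (proj₂ (minMax x xs′)))

  mirror-minMax : MinMax m M (mirror xs)
  mirror-minMax = subst₂ (λ a b → MinMax a b (mirror xs)) (m+n∸m≡n M m) (m+n∸n≡m M m)
                         (minMax-∸ c (minMax x xs′))

  c′≡c : c′ ≡ c
  c′≡c = let min≡ , max≡ = minMax-unique mirror-minMax in cong₂ _+_ max≡ min≡

mirror-injective : ∀ {xs ys} → mirror xs ≡ mirror ys → xs ≡ ys
mirror-injective {xs} {ys} eq = begin
  xs                 ≡⟨ mirror-involutive xs ⟨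
  mirror (mirror xs) ≡⟨ cong mirror eq ⟩
  mirror (mirror ys) ≡⟨ mirror-involutive ys ⟩
  ys                 ∎
  where open ≡-Reasoning

map-proj-injective : ∀ {A B : Set} {xs ys : List (A × B)} →
  map proj₁ xs ≡ map proj₁ ys → map proj₂ xs ≡ map proj₂ ys → xs ≡ ys
map-proj-injective {xs = []}    {[]}    _  _  = refl
map-proj-injective {xs = _ ∷ _} {_ ∷ _} e₁ e₂ with ∷-injective e₁ | ∷-injective e₂
... | refl , e₁′ | refl , e₂′ = cong (_ ∷_) (map-proj-injective e₁′ e₂′)

φᵛ : List Key → List ℕ × List ℕ
φᵛ vs = reverse (map wt vs) , reverse (mirror (map lvl vs))

φᵛ-injective : ∀ {vs vs′} → φᵛ vs ≡ φᵛ vs′ → vs ≡ vs′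
φᵛ-injective eq = map-proj-injective
  (reverse-injective (cong proj₁ eq))
  (mirror-injective (reverse-injective (cong proj₂ eq)))

φ≡φᵛ∘visitOrder : ∀ t → φ t ≡ φᵛ (visitOrder t)
φ≡φᵛ∘visitOrder t = cong₂ _,_ (reverse-map wt vs) (begin
  map (λ k → c ∸ lvl k) (reverse vs)  ≡⟨ map-∘ (reverse vs) ⟩
  map (c ∸_) (map lvl (reverse vs))   ≡⟨ cong (map (c ∸_)) (reverse-map lvl vs) ⟩
  map (c ∸_) (reverse (map lvl vs))   ≡⟨ reverse-map (c ∸_) (map lvl vs) ⟩
  reverse (mirror (map lvl vs))       ∎)
  where
  open ≡-Reasoning
  vs : List Key
  vs = visitOrder t
  c : ℕ
  c = maximum (map lvl vs) + minimum (map lvl vs)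

-- InversionCond p u v unfolds to Compatible v p × VisitedBefore u v.
VisitedBefore : Key → Key → Set
VisitedBefore x y = (wt y < wt x) ⊎ ((wt y ≡ wt x) × (lvl x < lvl y))

Sorted : List Tree → Set
Sorted = Linked (VisitedBefore on key)

visitsBefore-sound : ∀ x y → T (visitsBefore x y) → VisitedBefore x y
visitsBefore-sound (a , b) (c , d) before with to T-∨ before
... | inj₁ c<a = inj₁ (<ᵇ⇒< c a c<a)
... | inj₂ a≡c∧b<d with to T-∧ a≡c∧b<d
...   | a≡c , b<d = inj₂ (sym (≡ᵇ⇒≡ a c a≡c) , <ᵇ⇒< b d b<d)

visitsBefore-complete : ∀ x y → x ≢ y → ¬ T (visitsBefore x y) → VisitedBefore y x
visitsBefore-complete (a , b) (c , d) x≢y ¬before with <-cmp a c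
... | tri< a<c _ _ = inj₁ a<c
... | tri> _ _ c<a = ⊥-elim (¬before (from T-∨ (inj₁ (<⇒<ᵇ c<a))))
... | tri≈ _ refl _ with <-cmp b d
...   | tri< b<d _ _ = ⊥-elim (¬before (from T-∨ (inj₂ (from T-∧ (≡⇒≡ᵇ a a refl , <⇒<ᵇ b<d)))))
...   | tri≈ _ refl _ = ⊥-elim (x≢y refl)
...   | tri> _ _ d<b = inj₂ (refl , d<b)

insertT-↭ : ∀ x ys → insertT x ys ↭ x ∷ ys
insertT-↭ x []       = ↭-refl
insertT-↭ x (y ∷ ys) with visitsBefore (key x) (key y)
... | true  = ↭-refl
... | false = ↭-trans (prep y (insertT-↭ x ys)) (swap y x ↭-refl)

sortT-↭ : ∀ ts → sortT ts ↭ ts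
sortT-↭ []       = ↭-refl
sortT-↭ (t ∷ ts) = ↭-trans (insertT-↭ t (sortT ts)) (prep t (sortT-↭ ts))

insertT-head : ∀ {s} x ys → VisitedBefore (key s) (key x) →
  Connected (VisitedBefore on key) (just s) (List.head ys) →
  Connected (VisitedBefore on key) (just s) (List.head (insertT x ys))
insertT-head x []       s◁x _    = just s◁x
insertT-head x (y ∷ ys) s◁x s◁ys with visitsBefore (key x) (key y)
... | true  = just s◁x
... | false = s◁ys

insertT-sorted : ∀ x {ys} → All (λ y → key x ≢ key y) ys → Sorted ys → Sorted (insertT x ys)
insertT-sorted x {[]}     _              _      = [-]
insertT-sorted x {y ∷ ys} (x≢y ∷ x≢ys) sorted with visitsBefore (key x) (key y) in eq
... | true  = visitsBefore-sound (key x) (key y) (subst T (sym eq) tt) ∷ sorted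
... | false =
  insertT-head x ys (visitsBefore-complete (key x) (key y) x≢y (subst T eq)) (Linked.head′ sorted)
  ∷′ insertT-sorted x x≢ys (Linked.tail sorted)

sortT-sorted : ∀ ts → Unique (map key ts) → Sorted (sortT ts)
sortT-sorted []       _               = []
sortT-sorted (t ∷ ts) (t∉ts ∷ unique) =
  insertT-sorted t (All-resp-↭ (↭-sym (sortT-↭ ts)) (All.map⁻ t∉ts)) (sortT-sorted ts unique)

keys-canonF : ∀ ts → map key (canonF ts) ≡ map key ts
keys-canonF []                = refl
keys-canonF (node w l _ ∷ ts) = cong ((w , l) ∷_) (keys-canonF ts)

vertsF-↭ : ∀ {ts ts′} → ts ↭ ts′ → vertsF ts ↭ vertsF ts′
vertsF-↭ ↭-refl        = ↭-refl
vertsF-↭ (prep t p)    = ++⁺ˡ (verts t) (vertsF-↭ p)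
vertsF-↭ (swap t t′ p) =
  ↭-trans (++⁺ˡ (verts t) (++⁺ˡ (verts t′) (vertsF-↭ p))) (shifts (verts t) (verts t′))
vertsF-↭ (↭-trans p q) = ↭-trans (vertsF-↭ p) (vertsF-↭ q)

mutual
  descendants-canon-↭ : ∀ t → descendants (canon t) ↭ descendants t
  descendants-canon-↭ (node _ _ cs) = ↭-trans (vertsF-↭ (sortT-↭ (canonF cs))) (vertsF-canonF-↭ cs)

  vertsF-canonF-↭ : ∀ ts → vertsF (canonF ts) ↭ vertsF ts
  vertsF-canonF-↭ []                    = ↭-refl
  vertsF-canonF-↭ (t@(node w l _) ∷ ts) =
    ++⁺ (prep (w , l) (descendants-canon-↭ t)) (vertsF-canonF-↭ ts)

data Canonical (p : Key) : Tree → Set where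
  mk : ∀ {w l cs} → Compatible (w , l) p →
       All (λ v → ¬ InversionCond p (w , l) v) (vertsF cs) →
       Sorted cs → All (Canonical (w , l)) cs → Canonical p (node w l cs)

CanonicalForest : Key → List Tree → Set
CanonicalForest p F = Sorted F × All (Canonical p) F

edge⇒compatible : ∀ p k → EdgeOK p k → Compatible k p
edge⇒compatible (a , b) (c , d) (a≢c , b≢d , a<c⇔b<d) with <-cmp a c
... | tri< a<c _ _ = inj₂ (to a<c⇔b<d a<c , a<c)
... | tri≈ _ a≡c _ = ⊥-elim (a≢c a≡c)
... | tri> _ _ c<a with <-cmp b d
...   | tri< b<d _ _ = ⊥-elim (<⇒≯ (from a<c⇔b<d b<d) c<a)
...   | tri≈ _ b≡d _ = ⊥-elim (b≢d b≡d)
...   | tri> _ _ d<b = inj₁ (d<b , c<a)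

sortT-canonical : ∀ {p ts} → Unique (map key ts) → All (Canonical p) ts →
  CanonicalForest p (sortT ts)
sortT-canonical {ts = ts} unique canonical =
  sortT-sorted ts unique , All-resp-↭ (↭-sym (sortT-↭ ts)) canonical

mutual
  canonNode-canonical : ∀ {p w l cs} → Compatible (w , l) p → SiblingsDistinct cs →
    All (TieredBelow (w , l)) cs → NoInvBelow p (node w l cs) → Canonical p (canon (node w l cs))
  canonNode-canonical {w = w} {l} {cs} compatible distinct tiered (mk noInv noInvs)
    with sortT-canonical (subst Unique (sym (keys-canonF cs)) distinct) (canonF-canonical tiered noInvs)
  ... | sorted , canonical =
    mk compatible (All-resp-↭ (↭-sym (descendants-canon-↭ (node w l cs))) noInv) sorted canonical

  canonF-canonical : ∀ {k ts} → All (TieredBelow k) ts → All (NoInvBelow k) ts →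
    All (Canonical k) (canonF ts)
  canonF-canonical []                                     []                = []
  canonF-canonical (mk _ _ edge distinct tiered ∷ tiereds) (noInv ∷ noInvs) =
    canonNode-canonical (edge⇒compatible _ _ edge) distinct tiered noInv
    ∷ canonF-canonical tiereds noInvs

children : Tree → List Tree
children (node _ _ cs) = cs

rootChildren-canonical : ∀ {t} → Tiered t → NoInversion t →
  CanonicalForest (0 , 0) (children (canon t))
rootChildren-canonical {node _ _ cs} (mk distinct tiereds) noInvs =
  sortT-canonical (subst Unique (sym (keys-canonF cs)) distinct) (canonical tiereds noInvs)
  where
  canonical : ∀ {ts} → All TieredBelowRoot ts → All (NoInvBelow (0 , 0)) ts →
    All (Canonical (0 , 0)) (canonF ts)
  canonical []                                     []                = []
  canonical (mk 1≤w 1≤l distinct tiered ∷ tiereds) (noInv ∷ noInvs) =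
    canonNode-canonical (inj₂ (1≤l , 1≤w)) distinct tiered noInv ∷ canonical tiereds noInvs

++-split : ∀ {A : Set} (xs xs′ : List A) {ys ys′} → xs ++ ys ≡ xs′ ++ ys′ →
  (xs ≡ xs′ × ys ≡ ys′)
  ⊎ (∃₂ λ z zs → xs′ ≡ xs ++ z ∷ zs × ys ≡ z ∷ zs ++ ys′)
  ⊎ (∃₂ λ z zs → xs ≡ xs′ ++ z ∷ zs × ys′ ≡ z ∷ zs ++ ys)
++-split []       []         eq = inj₁ (refl , eq)
++-split []       (x′ ∷ xs′) eq = inj₂ (inj₁ (x′ , xs′ , refl , eq))
++-split (x ∷ xs) []         eq = inj₂ (inj₂ (x , xs , refl , sym eq))
++-split (x ∷ xs) (x′ ∷ xs′) eq with ∷-injective eq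
... | refl , eq′ with ++-split xs xs′ eq′
...   | inj₁ (xs≡ , ys≡)                  = inj₁ (cong (x ∷_) xs≡ , ys≡)
...   | inj₂ (inj₁ (z , zs , xs′≡ , ys≡)) = inj₂ (inj₁ (z , zs , cong (x ∷_) xs′≡ , ys≡))
...   | inj₂ (inj₂ (z , zs , xs≡ , ys′≡)) = inj₂ (inj₂ (z , zs , cong (x ∷_) xs≡ , ys′≡))

properPrefix-inversion : ∀ {p w l cs F vs z zs rest} →
  All (λ v → ¬ InversionCond p (w , l) v) vs → CanonicalForest p (node w l cs ∷ F) →
  vs ≡ vertsF cs ++ z ∷ zs → vertsF F ≡ z ∷ rest → ⊥
properPrefix-inversion _ ([-] , _) _ ()
properPrefix-inversion {cs = cs} noInv (visitedBefore ∷ _ , _ ∷ mk compatible _ _ _ ∷ _) vs≡ refl =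
  All.lookup noInv (subst (_ ∈_) (sym vs≡) (∈-++⁺ʳ (vertsF cs) (here refl)))
    (compatible , visitedBefore)

vertsF-injective : ∀ {p F F′} → CanonicalForest p F → CanonicalForest p F′ →
  vertsF F ≡ vertsF F′ → F ≡ F′
vertsF-injective (_ , []) (_ , []) _ = refl
vertsF-injective (_ , mk _ _ _ _ ∷ _) (_ , []) ()
vertsF-injective (_ , []) (_ , mk _ _ _ _ ∷ _) ()
vertsF-injective {F = node w l cs ∷ F} {node _ _ cs′ ∷ F′}
  canonicalF@(sortedF , mk _ noInv sorted canonical ∷ canonicals)
  canonicalF′@(sortedF′ , mk _ noInv′ sorted′ canonical′ ∷ canonicals′) eq
  with ∷-injective eq
... | refl , eq′ with ++-split (vertsF cs) (vertsF cs′) eq′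
...   | inj₁ (cs≡ , F≡) = cong₂ _∷_
  (cong (node w l) (vertsF-injective (sorted , canonical) (sorted′ , canonical′) cs≡))
  (vertsF-injective (Linked.tail sortedF , canonicals) (Linked.tail sortedF′ , canonicals′) F≡)
...   | inj₂ (inj₁ (_ , _ , cs′≡ , F≡)) = ⊥-elim (properPrefix-inversion noInv′ canonicalF cs′≡ F≡)
...   | inj₂ (inj₂ (_ , _ , cs≡ , F′≡)) = ⊥-elim (properPrefix-inversion noInv canonicalF′ cs≡ F′≡)

mutual
  ≅-refl : ∀ {t} → t ≅ t
  ≅-refl {node _ _ _} = node refl refl (refl ≅-reflᴾ)

  ≅-reflᴾ : ∀ {ts} → Pointwise _≅_ ts ts
  ≅-reflᴾ {[]}    = []
  ≅-reflᴾ {_ ∷ _} = ≅-refl ∷ ≅-reflᴾ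

≅-trans : ∀ {t₁ t₂ t₃} → t₁ ≅ t₂ → t₂ ≅ t₃ → t₁ ≅ t₃
≅-trans (node refl refl p) (node refl refl q) = node refl refl (trans p q)

↭⇒Permutation-≅ : ∀ {ts ts′} → ts ↭ ts′ → Permutation _≅_ ts ts′
↭⇒Permutation-≅ p = Homogeneous.map (λ { refl → ≅-refl }) (↭⇒↭ₛ p)

mutual
  ≅-canon : ∀ t → t ≅ canon t
  ≅-canon (node _ _ cs) =
    node refl refl (trans (refl (≅-canonF cs)) (↭⇒Permutation-≅ (↭-sym (sortT-↭ (canonF cs)))))

  ≅-canonF : ∀ ts → Pointwise _≅_ ts (canonF ts)
  ≅-canonF []       = []
  ≅-canonF (t ∷ ts) = ≅-canon t ∷ ≅-canonF ts

mutual
  canon-≅ : ∀ t → canon t ≅ t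
  canon-≅ (node _ _ cs) =
    node refl refl (trans (↭⇒Permutation-≅ (sortT-↭ (canonF cs))) (refl (canonF-≅ cs)))

  canonF-≅ : ∀ ts → Pointwise _≅_ (canonF ts) ts
  canonF-≅ []       = []
  canonF-≅ (t ∷ ts) = canon-≅ t ∷ canonF-≅ ts

canon≡⇒≅ : ∀ {t t′} → canon t ≡ canon t′ → t ≅ t′
canon≡⇒≅ {t} {t′} eq = ≅-trans (≅-canon t) (subst (_≅ t′) (sym eq) (canon-≅ t′))

tiered-canon-injective : ∀ {t t′} → Tiered t → NoInversion t → Tiered t′ → NoInversion t′ →
  visitOrder t ≡ visitOrder t′ → canon t ≡ canon t′
tiered-canon-injective tiered@(mk _ _) noInv tiered′@(mk _ _) noInv′ eq =
  cong (node 0 0)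
    (vertsF-injective (rootChildren-canonical tiered noInv) (rootChildren-canonical tiered′ noInv′) eq)

proposition4p8 : (n : ℕ) → 1 ≤ n → (T T′ : Tree) →
    InZRTT₀ n T → InZRTT₀ n T′ → φ T ≡ φ T′ → T ≅ T′
proposition4p8 _ _ T T′ (tiered , noInv , _) (tiered′ , noInv′ , _) φ≡ =
  canon≡⇒≅ (tiered-canon-injective tiered noInv tiered′ noInv′ (φᵛ-injective φᵛ≡))
  where
  open ≡-Reasoning
  φᵛ≡ : φᵛ (visitOrder T) ≡ φᵛ (visitOrder T′)
  φᵛ≡ = begin
    φᵛ (visitOrder T)   ≡⟨ φ≡φᵛ∘visitOrder T ⟨
    φ T                 ≡⟨ φ≡ ⟩
    φ T′                ≡⟨ φ≡φᵛ∘visitOrder T′ ⟩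
    φᵛ (visitOrder T′)  ∎
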